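{- There are infinitely many pairs $(b,y)$ of integers with $b\ge 2$, $y\ge 1$, for which there exists a word $w$ over $\{0,1,\dots,b-1\}$ with $|w|=3$ such that $(y^3)_b = w\uparrow 2$; equivalently, infinitely many positive integer solutions $(b,y,c)$ of $y^3=c(b^3+1)$ with $b^2\le c<b^3$.
   Context: $(m)_b$ denotes the canonical base-$b$ representation of the integer $m$ (no leading zeros); $|w|$ is the length of the word $w$ and $w\uparrow n$ is the concatenation of $n$ copies of $w$. -}

module Defs where

open import Data.Nat using (ℕ; zero; suc; _+_; _*_; _^_; _≤_; _<_; _/_; _%_; NonZero)
open import Data.Nat.DivMod using (m/n<m)
open import Data.Nat.Induction using (<-wellFounded)
open import Induction.WellFounded using (Acc; acc)
open import Data.List using (List; []; _∷_; _++_; [_]; length)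
open import Data.Product using (Σ; _×_)
open import Relation.Binary.PropositionalEquality using (_≡_)
open import Data.List.Relation.Unary.All using (All)

-- Canonical base-b representation (b ≥ 2), most significant digit first,
-- no leading zeros; the representation of 0 is the empty word.
-- Digits are natural numbers (each < b by construction).
digitsAcc : (b : ℕ) → (n : ℕ) → Acc _<_ n → List ℕ
digitsAcc b zero _ = []
digitsAcc zero (suc n) _ = []          -- base 0/1 not used
digitsAcc (suc zero) (suc n) _ = []
digitsAcc (suc (suc k)) (suc n) (acc rs) =
  digitsAcc (suc (suc k)) (suc n / suc (suc k))
    (rs (m/n<m (suc n) (suc (suc k)) (Data.Nat.s≤s (Data.Nat.s≤s Data.Nat.z≤n))))
  ++ [ suc n % suc (suc k) ]

rep : (b : ℕ) → ℕ → List ℕ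
rep b m = digitsAcc b m (<-wellFounded m)

_↑_ : {A : Set} → List A → ℕ → List A
w ↑ zero = []
w ↑ suc n = w ++ (w ↑ n)

IsWord : ℕ → List ℕ → Set
IsWord b w = All (λ d → d < b) w

Good : ℕ → ℕ → Set
Good b y = 2 ≤ b × 1 ≤ y ×
  Σ (List ℕ) (λ w → IsWord b w × length w ≡ 3 × rep b (y ^ 3) ≡ w ↑ 2)

{-# OPTIONS --safe #-}
-- For b = 8r + 7 we have b³ + 1 = (b + 1)(b² − b + 1) = 8(r + 1)(64r² + 104r + 43).
-- Whenever the second factor equals 3s², the number y = 12s(r + 1) satisfies
-- y³ = c(b³ + 1) with c = 72s(r + 1)², and b² ≤ c < b³ because s ≈ 8r/√3; so the
-- base-b expansion of y³ is the three digits of c written twice.  The Pell-type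
-- equation 3s² = 64r² + 104r + 43 has the solution (2, 13), and an automorphism of
-- it produces infinitely many more.
module Submission where

open import Defs
open import Data.Nat
open import Data.Nat.Properties
open import Data.Nat.DivMod
open import Data.Nat.Divisibility using (divides)
open import Data.Nat.Tactic.RingSolver using (solve-∀)
open import Data.Nat.Induction using (<-wellFounded)
open import Induction.WellFounded using (Acc; acc)
open import Data.List using (List; []; _∷_; _++_; [_]; length; foldl)
open import Data.List.Properties using (++-assoc; ++-identityʳ; foldl-++)
open import Data.List.Relation.Unary.All using (All; []; _∷_)
open import Data.List.Relation.Unary.All.Properties using (++⁺)
open import Data.Product using (Σ; _×_; _,_)
open import Relation.Nullary using (yes; no; contradiction)
open import Relation.Binary.PropositionalEquality hiding ([_])

digitsAcc-irrelevant : ∀ b n (a a′ : Acc _<_ n) → digitsAcc b n a ≡ digitsAcc b n a′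
digitsAcc-irrelevant b zero _ _ = refl
digitsAcc-irrelevant zero (suc n) _ _ = refl
digitsAcc-irrelevant (suc zero) (suc n) _ _ = refl
digitsAcc-irrelevant b@(suc (suc _)) (suc n) (acc _) (acc _) =
  cong (_++ [ suc n % b ]) (digitsAcc-irrelevant b (suc n / b) _ _)

rep-suc : ∀ k n → let b = suc (suc k) in rep b (suc n) ≡ rep b (suc n / b) ++ [ suc n % b ]
rep-suc k n = unfold (<-wellFounded (suc n))
  where
  b : ℕ
  b = suc (suc k)
  unfold : (a : Acc _<_ (suc n)) → digitsAcc b (suc n) a ≡ rep b (suc n / b) ++ [ suc n % b ]
  unfold (acc _) = cong (_++ [ suc n % b ]) (digitsAcc-irrelevant b (suc n / b) _ _)

rep-snoc : ∀ {b d m} → 2 ≤ b → d < b → 1 ≤ d + m * b → rep b (d + m * b) ≡ rep b m ++ [ d ]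
rep-snoc {b@(suc (suc k))} {d} {m} (s≤s (s≤s z≤n)) d<b _ with d + m * b in eq
... | suc n = trans (rep-suc k n) (cong₂ (λ q r → rep b q ++ [ r ]) quotient remainder)
  where
  open ≡-Reasoning
  quotient : suc n / b ≡ m
  quotient = begin
    suc n / b          ≡⟨ cong (_/ b) eq ⟨
    (d + m * b) / b    ≡⟨ +-distrib-/-∣ʳ d (divides m refl) ⟩
    d / b + m * b / b  ≡⟨ cong₂ _+_ (m<n⇒m/n≡0 d<b) (m*n/n≡m m b) ⟩
    m                  ∎
  remainder : suc n % b ≡ d
  remainder = begin
    suc n % b        ≡⟨ cong (_% b) eq ⟨
    (d + m * b) % b  ≡⟨ [m+kn]%n≡m%n d m b ⟩
    d % b            ≡⟨ m<n⇒m%n≡m d<b ⟩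
    d                ∎

horner : ℕ → ℕ → List ℕ → ℕ
horner b = foldl (λ n d → d + n * b)

rep-horner-acc : ∀ {b n ds} → 2 ≤ b → 1 ≤ n → All (_< b) ds →
  rep b (horner b n ds) ≡ rep b n ++ ds
rep-horner-acc {ds = []} _ _ [] = sym (++-identityʳ _)
rep-horner-acc {b} {n} {d ∷ ds} 2≤b 1≤n (d<b ∷ ds<b) = begin
  rep b (horner b (d + n * b) ds)  ≡⟨ rep-horner-acc 2≤b 1≤n′ ds<b ⟩
  rep b (d + n * b) ++ ds          ≡⟨ cong (_++ ds) (rep-snoc {m = n} 2≤b d<b 1≤n′) ⟩
  (rep b n ++ [ d ]) ++ ds         ≡⟨ ++-assoc (rep b n) [ d ] ds ⟩
  rep b n ++ d ∷ ds                ∎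
  where
  open ≡-Reasoning
  1≤n′ : 1 ≤ d + n * b
  1≤n′ = ≤-trans (*-mono-≤ 1≤n (≤-trans (s≤s z≤n) 2≤b)) (m≤n+m (n * b) d)

rep-horner : ∀ {b d ds} → 2 ≤ b → 1 ≤ d → All (_< b) (d ∷ ds) → rep b (horner b 0 (d ∷ ds)) ≡ d ∷ ds
rep-horner {b} {d} 2≤b 1≤d (d<b ∷ ds<b) =
  trans (rep-horner-acc 2≤b 1≤d+0 ds<b) (cong (_++ _) (rep-snoc {m = 0} 2≤b d<b 1≤d+0))
  where
  1≤d+0 : 1 ≤ d + 0 * b
  1≤d+0 = ≤-trans 1≤d (m≤m+n _ 0)

horner-shift : ∀ b n ds → horner b n ds ≡ n * b ^ length ds + horner b 0 ds
horner-shift b n [] = sym (trans (+-identityʳ (n * 1)) (*-identityʳ n))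
horner-shift b n (d ∷ ds) = begin
  horner b (d + n * b) ds                       ≡⟨ horner-shift b (d + n * b) ds ⟩
  (d + n * b) * B + horner b 0 ds               ≡⟨ regroup d n b B (horner b 0 ds) ⟩
  n * (b * B) + ((d + 0) * B + horner b 0 ds)   ≡⟨ cong (n * (b * B) +_) (horner-shift b (d + 0) ds) ⟨
  n * (b * B) + horner b (d + 0) ds             ∎
  where
  open ≡-Reasoning
  B : ℕ
  B = b ^ length ds
  regroup : ∀ d n b B H → (d + n * b) * B + H ≡ n * (b * B) + ((d + 0) * B + H)
  regroup = solve-∀

horner-↑2 : ∀ b w → horner b 0 (w ↑ 2) ≡ horner b 0 w * (b ^ length w + 1)
horner-↑2 b w = begin
  horner b 0 (w ++ (w ++ []))    ≡⟨ foldl-++ _ 0 w (w ++ []) ⟩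
  horner b h (w ++ [])           ≡⟨ cong (horner b h) (++-identityʳ w) ⟩
  horner b h w                   ≡⟨ horner-shift b h w ⟩
  h * b ^ length w + h           ≡⟨ cong (h * b ^ length w +_) (*-identityʳ h) ⟨
  h * b ^ length w + h * 1       ≡⟨ *-distribˡ-+ h (b ^ length w) 1 ⟨
  h * (b ^ length w + 1)         ∎
  where
  open ≡-Reasoning
  h : ℕ
  h = horner b 0 w

threeDigits : (b c : ℕ) .{{_ : NonZero b}} → List ℕ
threeDigits b c = c / b / b ∷ c / b % b ∷ c % b ∷ []

horner-threeDigits : ∀ b c .{{_ : NonZero b}} → horner b 0 (threeDigits b c) ≡ c
horner-threeDigits b c = begin
  c % b + (c / b % b + (c / b / b + 0) * b) * b  ≡⟨ cong (λ x → c % b + (c / b % b + x * b) * b) (+-identityʳ (c / b / b)) ⟩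
  c % b + (c / b % b + c / b / b * b) * b        ≡⟨ cong (λ x → c % b + x * b) (m≡m%n+[m/n]*n (c / b) b) ⟨
  c % b + c / b * b                              ≡⟨ m≡m%n+[m/n]*n c b ⟨
  c                                              ∎
  where open ≡-Reasoning

y³≡c[b³+1]⇒Good : ∀ {b y c} → 2 ≤ b → 1 ≤ y → b * b ≤ c → c < b * (b * b) → y ^ 3 ≡ c * (b ^ 3 + 1) → Good b y
y³≡c[b³+1]⇒Good {b@(suc (suc _))} {y} {c} 2≤b@(s≤s (s≤s z≤n)) 1≤y lo hi cube =
  2≤b , 1≤y , w , digits<b , refl , (begin
    rep b (y ^ 3)                              ≡⟨ cong (rep b) cube ⟩
    rep b (c * (b ^ 3 + 1))                    ≡⟨ cong (λ x → rep b (x * (b ^ 3 + 1))) (horner-threeDigits b c) ⟨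
    rep b (horner b 0 w * (b ^ length w + 1))  ≡⟨ cong (rep b) (horner-↑2 b w) ⟨
    rep b (horner b 0 (w ↑ 2))                 ≡⟨ rep-horner 2≤b leading≥1 (++⁺ digits<b (++⁺ digits<b [])) ⟩
    w ↑ 2                                      ∎)
  where
  open ≡-Reasoning
  w : List ℕ
  w = threeDigits b c
  leading≡ : c / b / b ≡ c / (b * b)
  leading≡ = m/n/o≡m/[n*o] c b b
  leading≥1 : 1 ≤ c / b / b
  leading≥1 = subst (1 ≤_) (sym leading≡) (m≥n⇒m/n>0 lo)
  digits<b : All (_< b) w
  digits<b = subst (_< b) (sym leading≡) (m<n*o⇒m/o<n {c} {b} {b * b} hi)
           ∷ m%n<n (c / b) b ∷ m%n<n c b ∷ []

square-cancel-< : ∀ {m n} → m * m < n * n → m < n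
square-cancel-< {m} {n} m²<n² with m <? n
... | yes m<n = m<n
... | no m≮n = contradiction m²<n² (≤⇒≯ (*-mono-≤ (≮⇒≥ m≮n) (≮⇒≥ m≮n)))

record PellSolution : Set where
  constructor pell
  field
    r s : ℕ
    equation : 3 * (s * s) ≡ 64 * (r * r) + 104 * r + 43

open PellSolution

-- With X = 16r + 13 the equation reads X² − 3(2s)² = −3; nextPell multiplies
-- X + 2s√3 by the unit 97 + 56√3.
nextPell : PellSolution → PellSolution
nextPell (pell r s eq) = pell (97 * r + 21 * s + 78) s′
  (+-cancelʳ-≡ (3 * (s * s)) _ _ (trans (cong (3 * (s′ * s′) +_) eq) (step r s)))
  where
  s′ : ℕ
  s′ = 448 * r + 97 * s + 364
  step : ∀ x z → 3 * ((448 * x + 97 * z + 364) * (448 * x + 97 * z + 364)) + (64 * (x * x) + 104 * x + 43)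
    ≡ (64 * ((97 * x + 21 * z + 78) * (97 * x + 21 * z + 78)) + 104 * (97 * x + 21 * z + 78) + 43)
      + 3 * (z * z)
  step = solve-∀

r<r-nextPell : (p : PellSolution) → r p < r (nextPell p)
r<r-nextPell (pell r s _) = begin-strict
  r                     <⟨ n<1+n r ⟩
  1 + r                 ≡⟨ +-comm 1 r ⟩
  r + 1                 ≤⟨ +-mono-≤ (≤-trans (m≤n*m r 97) (m≤m+n (97 * r) (21 * s))) (s≤s z≤n) ⟩
  97 * r + 21 * s + 78  ∎
  where open ≤-Reasoning

pellSolution : ℕ → PellSolution
pellSolution zero = pell 2 13 refl
pellSolution (suc n) = nextPell (pellSolution n)

n<r-pellSolution : ∀ n → n < r (pellSolution n)
n<r-pellSolution zero = s≤s z≤n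
n<r-pellSolution (suc n) = ≤-trans (s≤s (n<r-pellSolution n)) (r<r-nextPell (pellSolution n))

s-positive : (p : PellSolution) → 1 ≤ s p
s-positive (pell r zero eq) = contradiction eq (<⇒≢ (≤-trans (s≤s z≤n) (m≤n+m 43 (64 * (r * r) + 104 * r))))
s-positive (pell r (suc _) _) = s≤s z≤n

s<5[1+r] : (p : PellSolution) → s p < 5 * (1 + r p)
s<5[1+r] (pell r s eq) = square-cancel-< (*-cancelˡ-< 3 (s * s) (t * t) (begin-strict
  3 * (s * s)                                          ≡⟨ eq ⟩
  64 * (r * r) + 104 * r + 43                          <⟨ m<m+n _ z<s ⟩
  64 * (r * r) + 104 * r + 43 + suc (11 * (r * r) + 46 * r + 31)  ≡⟨ expand r ⟨
  3 * (t * t)                                          ∎))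
  where
  open ≤-Reasoning
  t : ℕ
  t = 5 * (1 + r)
  expand : ∀ x → 3 * (5 * (1 + x) * (5 * (1 + x))) ≡ 64 * (x * x) + 104 * x + 43 + suc (11 * (x * x) + 46 * x + 31)
  expand = solve-∀

PellSolution⇒Good : (p : PellSolution) → 1 ≤ r p → Good (8 * r p + 7) (12 * s p * (1 + r p))
PellSolution⇒Good p@(pell r@(suc t) s eq) _ = y³≡c[b³+1]⇒Good 2≤b 1≤y b²≤c c<b³ y³≡c[b³+1]
  where
  open ≤-Reasoning
  b R K c : ℕ
  b = 8 * r + 7
  R = 1 + r
  K = 72 * (R * R)
  c = s * K
  2≤b : 2 ≤ b
  2≤b = ≤-trans (s≤s (s≤s z≤n)) (m≤n+m 7 (8 * r))
  1≤y : 1 ≤ 12 * s * R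
  1≤y = *-mono-≤ (*-mono-≤ {1} {12} (s≤s z≤n) (s-positive p)) (s≤s z≤n)
  b²≤c : b * b ≤ c
  b²≤c = begin
    b * b                 ≤⟨ m≤m+n (b * b) (16 * r + 15) ⟩
    b * b + (16 * r + 15) ≡⟨ square r ⟩
    64 * (R * R)          ≤⟨ *-monoˡ-≤ (R * R) (m≤m+n 64 8) ⟩
    K                     ≡⟨ *-identityˡ K ⟨
    1 * K                 ≤⟨ *-monoˡ-≤ K (s-positive p) ⟩
    c                     ∎
    where
    square : ∀ x → (8 * x + 7) * (8 * x + 7) + (16 * x + 15) ≡ 64 * ((1 + x) * (1 + x))
    square = solve-∀
  c<b³ : c < b * (b * b)
  c<b³ = begin-strict
    c                                                <⟨ *-monoˡ-< K (s<5[1+r] p) ⟩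
    5 * R * K                                        ≤⟨ m≤m+n (5 * R * K) _ ⟩
    5 * R * K + (152 * (t * (t * t)) + 720 * (t * t) + 1080 * t + 495)  ≡⟨ cube t ⟨
    b * (b * b)                                      ∎
    where
    cube : ∀ x → (8 * (1 + x) + 7) * ((8 * (1 + x) + 7) * (8 * (1 + x) + 7))
      ≡ 5 * (2 + x) * (72 * ((2 + x) * (2 + x))) + (152 * (x * (x * x)) + 720 * (x * x) + 1080 * x + 495)
    cube = solve-∀
  y³≡c[b³+1] : (12 * s * R) ^ 3 ≡ c * (b ^ 3 + 1)
  y³≡c[b³+1] = begin-equality
    (12 * s * R) ^ 3                   ≡⟨ cube-y r s ⟩
    c * (8 * R * (3 * (s * s)))        ≡⟨ cong (λ x → c * (8 * R * x)) eq ⟩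
    c * (8 * R * (64 * (r * r) + 104 * r + 43))  ≡⟨ cong (c *_) (sum-of-cubes r) ⟨
    c * (b ^ 3 + 1)                    ∎
    where
    cube-y : ∀ x z → 12 * z * (1 + x) * (12 * z * (1 + x) * (12 * z * (1 + x) * 1))
      ≡ z * (72 * ((1 + x) * (1 + x))) * (8 * (1 + x) * (3 * (z * z)))
    cube-y = solve-∀
    sum-of-cubes : ∀ x → (8 * x + 7) * ((8 * x + 7) * ((8 * x + 7) * 1)) + 1
      ≡ 8 * (1 + x) * (64 * (x * x) + 104 * x + 43)
    sum-of-cubes = solve-∀

mainTheorem12 : (N : ℕ) → Σ ℕ (λ b → Σ ℕ (λ y → N ≤ b + y × Good b y))
mainTheorem12 N = 8 * r p + 7 , 12 * s p * (1 + r p) , N≤b+y , PellSolution⇒Good p (≤-trans (s≤s z≤n) N<r)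
  where
  open ≤-Reasoning
  p : PellSolution
  p = pellSolution N
  N<r : N < r p
  N<r = n<r-pellSolution N
  N≤b+y : N ≤ 8 * r p + 7 + 12 * s p * (1 + r p)
  N≤b+y = begin
    N                  ≤⟨ <⇒≤ N<r ⟩
    r p                ≤⟨ m≤n*m (r p) 8 ⟩
    8 * r p            ≤⟨ m≤m+n (8 * r p) 7 ⟩
    8 * r p + 7        ≤⟨ m≤m+n (8 * r p + 7) _ ⟩
    8 * r p + 7 + 12 * s p * (1 + r p)  ∎
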